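{- Let $p\ge 29$ be a prime and $G=D_{2p}$. Then $\tilde{l}\ge\lfloor 2\sqrt{2p}\rfloor-2$.
   Context: $D_{2p}=\langle x,y\mid x^p=y^2=1,\ y^{ -1}xy=x^{ -1}\rangle$. A Cayley subset of $G$ is a subset $S\subset G\setminus\{1\}$ with $S=S^{ -1}$ generating $G$. The Cayley graph $X(S)$ has vertex set $G$, $g,h$ adjacent iff $g^{ -1}h\in S$. A connected $k$-regular graph is Ramanujan if $\mu\le 2\sqrt{k-1}$, $\mu$ being the maximum of $|\lambda|$ over adjacency eigenvalues with $|\lambda|\ne k$. Let $\widetilde{\mathcal{S}}$ be the set of all Cayley subsets of $G$, $\widetilde{\mathcal{L}}=\{2p-|S|:S\in\widetilde{\mathcal{S}}\}$, and $\tilde{l}=\max\{l\in\widetilde{\mathcal{L}}:\ X(S)$ is Ramanujan for every $S\in\widetilde{\mathcal{S}}$ with $1\le 2p-|S|\le l\}$. -}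

module Defs where

open import Data.Nat as ℕ using (ℕ; zero; suc; NonZero)
open import Data.Nat.DivMod using (_mod_)
open import Data.Fin using (Fin; toℕ)
open import Data.Bool using (Bool; true; false; _xor_; if_then_else_)
open import Data.List using (List; []; _∷_; map; _++_; foldr; filter; length; allFin)
open import Data.List.Relation.Unary.All using (All)
open import Data.Product using (Σ; _×_; _,_; ∃; ∃-syntax)
open import Relation.Binary.PropositionalEquality using (_≡_; _≢_)
open import Relation.Nullary using (¬_)
open import Algebra.Structures using (IsCommutativeRing)
open import Relation.Binary.Structures using (IsTotalOrder)

-- The real numbers, given axiomatically as a complete ordered field
-- (any such structure is, classically, isomorphic to ℝ).

record RealField : Set₁ where
  infixl 6 _+_
  infixl 7 _*_
  infix 4 _≤_
  field
    Carrier : Set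
    0# 1#   : Carrier
    _+_ _*_ : Carrier → Carrier → Carrier
    -_      : Carrier → Carrier
    _≤_     : Carrier → Carrier → Set
    isCommutativeRing : IsCommutativeRing _≡_ _+_ _*_ -_ 0# 1#
    0≢1     : 0# ≢ 1#
    *-inverse : ∀ x → x ≢ 0# → ∃[ y ] (x * y ≡ 1#)
    isTotalOrder : IsTotalOrder _≡_ _≤_
    +-mono-≤ : ∀ {x y} z → x ≤ y → x + z ≤ y + z
    *-nonneg : ∀ {x y} → 0# ≤ x → 0# ≤ y → 0# ≤ x * y
    lub : (P : Carrier → Set) → ∃ P → (∃[ u ] (∀ x → P x → x ≤ u)) →
          ∃[ s ] ((∀ x → P x → x ≤ s) ×
                  (∀ u → (∀ x → P x → x ≤ u) → s ≤ u))

  fromℕ : ℕ → Carrier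
  fromℕ zero    = 0#
  fromℕ (suc n) = 1# + fromℕ n

  sumR : List Carrier → Carrier
  sumR = foldr _+_ 0#

-- The dihedral group D_{2p} = ⟨x, y | x^p = y^2 = 1, y⁻¹xy = x⁻¹⟩.
-- The element (a , i) stands for x^i y^a  (a = false ↦ y^0, true ↦ y^1).

module Dihedral (p : ℕ) .{{_ : NonZero p}} where

  D : Set
  D = Bool × Fin p

  e : D
  e = false , (0 mod p)

  -- x^i y^a · x^j y^b = x^(i + (-1)^a j) y^(a+b)
  _·_ : D → D → D
  (false , i) · (b , j) = b , ((toℕ i ℕ.+ toℕ j) mod p)
  (true  , i) · (b , j) = (true xor b) , ((toℕ i ℕ.+ (p ℕ.∸ toℕ j)) mod p)

  inv : D → D
  inv (false , i) = false , ((p ℕ.∸ toℕ i) mod p)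
  inv (true  , i) = true , i

  prod : List D → D
  prod = foldr _·_ e

  elements : List D
  elements = map (false ,_) (allFin p) ++ map (true ,_) (allFin p)

  Subset : Set
  Subset = D → Bool

  _∈S_ : D → Subset → Set
  g ∈S S = S g ≡ true

  card : Subset → ℕ
  card S = length (filter (λ g → Data.Bool._≟_ (S g) true) elements)

  record CayleySubset (S : Subset) : Set where
    field
      no-identity : ¬ (e ∈S S)
      symmetric   : ∀ g → g ∈S S → inv g ∈S S
      generates   : ∀ g → ∃[ w ] (All (_∈S S) w × prod w ≡ g)

  InL : ℕ → Set
  InL l = ∃[ S ] (CayleySubset S × (2 ℕ.* p) ℕ.∸ card S ≡ l)

  module _ (R : RealField) where
    open RealField R

    adj : Subset → D → D → Carrier
    adj S g h = if S (inv g · h) then 1# else 0#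

    -- λ is an adjacency eigenvalue of X(S) (real eigenvector, the matrix
    -- being real symmetric)
    IsEigenvalue : Subset → Carrier → Set
    IsEigenvalue S λ′ =
      Σ (D → Carrier) λ v → ((∃[ g ] (v g ≢ 0#)) ×
              (∀ g → sumR (map (λ h → adj S g h * v h) elements) ≡ λ′ * v g))

    -- X(S) (which is |S|-regular) is Ramanujan: every eigenvalue λ with
    -- |λ| ≠ k satisfies |λ| ≤ 2√(k-1), written as λ² ≤ 4(k-1).
    Ramanujan : Subset → Set
    Ramanujan S =
      (λ′ : Carrier) → IsEigenvalue S λ′ →
        λ′ ≢ fromℕ (card S) → λ′ ≢ - fromℕ (card S) →
        λ′ * λ′ ≤ fromℕ (4 ℕ.* (card S ℕ.∸ 1))

{-# OPTIONS --safe #-}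

-- Let A be the adjacency matrix of X(S), k = |S|, and B the matrix of the complementary
-- relation g⁻¹h ∉ S, so that A + B is the all-ones matrix.  Left division permutes D_{2p},
-- so every column of A sums to k and every row of B to 2p − k.  If Av = λv with λ ≠ k,
-- summing the entries gives λ Σv = k Σv, hence Σv = 0 and Bv = −λv; reading this off at a
-- coordinate where |v| is maximal yields |λ| ≤ 2p − k.  With b = ⌊√(8p)⌋, every Cayley
-- subset with 2p − k ≤ b − 2 thus satisfies λ² ≤ (2p − k)² ≤ 4(k − 1), and l = b − 2 is
-- itself of the form 2p − |S|: take all non-trivial rotations and p − l + 1 reflections.

module Submission where

open import Defs
open import Level using (0ℓ)
open import Data.Nat as ℕ using (ℕ; zero; suc; NonZero)
import Data.Nat.Properties as ℕ
open import Data.Nat.DivMod using (_mod_)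
open import Data.Fin as Fin using (Fin; toℕ)
open import Data.Fin.Properties using (toℕ-injective; toℕ<n; toℕ-fromℕ<)
open import Data.Fin.Permutation using (Permutation′; permutation)
open import Data.Bool using (Bool; true; false; not; if_then_else_)
import Data.Bool as Bool
open import Data.List using (List; []; _∷_; map; _++_; filter; length; tabulate; allFin)
open import Data.List.Properties using (filter-++; length-++; map-tabulate)
open import Data.List.Membership.Propositional using (_∈_)
import Data.List.Relation.Unary.All as All
open import Data.Product using (Σ; _×_; _,_; proj₁; proj₂; ∃-syntax)
open import Data.Nat.Primality using (Prime)
open import Data.Sum using (_⊎_; inj₁; inj₂)
open import Data.Bool.Properties using (T-≡)
open import Function.Bundles using (Equivalence)
open import Function using (_∘_)
open import Relation.Binary.Bundles using (Setoid; TotalOrder)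
open import Algebra.Bundles using (CommutativeRing)
import Relation.Binary.Reasoning.Setoid
import Relation.Binary.Reasoning.PartialOrder
open import Relation.Binary.PropositionalEquality
  using (_≡_; _≢_; refl; sym; trans; cong; cong₂; subst; subst₂; module ≡-Reasoning)

module Counting where
  open import Data.Nat using (_+_; _≤_; _<ᵇ_; z≤n; s≤s)

  count : {A : Set} → (A → Bool) → List A → ℕ
  count P xs = length (filter (λ x → P x Bool.≟ true) xs)

  count-++ : {A : Set} (P : A → Bool) (xs ys : List A) → count P (xs ++ ys) ≡ count P xs + count P ys
  count-++ P xs ys = trans (cong length (filter-++ (λ x → P x Bool.≟ true) xs ys)) (length-++ (filter _ xs))

  count-complement : {A : Set} (P : A → Bool) (xs : List A) → count P xs + count (not ∘ P) xs ≡ length xs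
  count-complement P [] = refl
  count-complement P (x ∷ xs) with P x
  ... | true  = cong suc (count-complement P xs)
  ... | false = trans (ℕ.+-suc _ _) (cong suc (count-complement P xs))

  count-tabulate-all : {A : Set} {m : ℕ} (P : A → Bool) (f : Fin m → A) →
                       (∀ i → P (f i) ≡ true) → count P (tabulate f) ≡ m
  count-tabulate-all {m = zero}  P f P∘f≡true = refl
  count-tabulate-all {m = suc m} P f P∘f≡true rewrite P∘f≡true Fin.zero =
    cong suc (count-tabulate-all P (f ∘ Fin.suc) (P∘f≡true ∘ Fin.suc))

  count-tabulate-<ᵇ : {A : Set} {m : ℕ} (P : A → Bool) (f : Fin m → A) (c : ℕ) → c ≤ m →
                      (∀ i → P (f i) ≡ (toℕ i <ᵇ c)) → count P (tabulate f) ≡ c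
  count-tabulate-<ᵇ {m = zero}  P f zero    z≤n       P∘f≡<ᵇc = refl
  count-tabulate-<ᵇ {m = suc m} P f zero    z≤n       P∘f≡<ᵇc rewrite P∘f≡<ᵇc Fin.zero =
    count-tabulate-<ᵇ P (f ∘ Fin.suc) zero z≤n (P∘f≡<ᵇc ∘ Fin.suc)
  count-tabulate-<ᵇ {m = suc m} P f (suc c) (s≤s c≤m) P∘f≡<ᵇc rewrite P∘f≡<ᵇc Fin.zero =
    cong suc (count-tabulate-<ᵇ P (f ∘ Fin.suc) c c≤m (P∘f≡<ᵇc ∘ Fin.suc))

open Counting

-- Translations and reflections of ℤ/pℤ, represented on Fin p

module Modular (n : ℕ) where

  open import Data.Nat using (_+_; _∸_; _%_; _≤_; _<_)
  open import Data.Nat.DivMod using (%-distribˡ-+; m%n%n≡m%n; n%n≡0; m%n<n; m<n⇒m%n≡m)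

  p : ℕ
  p = suc n

  infix 4 _≈_
  record _≈_ (x y : ℕ) : Set where
    constructor mk≈
    field %-≡ : x % p ≡ y % p

  ≈-setoid : Setoid 0ℓ 0ℓ
  ≈-setoid = record
    { _≈_           = _≈_
    ; isEquivalence = record
      { refl  = mk≈ refl
      ; sym   = λ (mk≈ e) → mk≈ (sym e)
      ; trans = λ (mk≈ e) (mk≈ f) → mk≈ (trans e f)
      }
    }

  open Setoid ≈-setoid using () renaming (refl to ≈-refl; reflexive to ≈-reflexive; trans to ≈-trans)
  module ≈-Reasoning = Relation.Binary.Reasoning.Setoid ≈-setoid

  %-≈ : ∀ x → x % p ≈ x
  %-≈ x = mk≈ (m%n%n≡m%n x p)

  p≈0 : p ≈ 0
  p≈0 = mk≈ (n%n≡0 p)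

  +-cong : ∀ {a b x y} → a ≈ b → x ≈ y → a + x ≈ b + y
  +-cong {a} {b} {x} {y} (mk≈ a≈b) (mk≈ x≈y) = mk≈ (begin
      (a + x) % p          ≡⟨ %-distribˡ-+ a x p ⟩
      (a % p + x % p) % p  ≡⟨ cong₂ (λ u v → (u + v) % p) a≈b x≈y ⟩
      (b % p + y % p) % p  ≡⟨ %-distribˡ-+ b y p ⟨
      (b + y) % p          ∎)
    where open ≡-Reasoning

  +-congˡ : ∀ a {x y} → x ≈ y → a + x ≈ a + y
  +-congˡ a = +-cong {a} {a} ≈-refl

  +-congʳ : ∀ x {a b} → a ≈ b → a + x ≈ b + x
  +-congʳ x a≈b = +-cong a≈b (≈-refl {x})

  ≈⇒≡ : ∀ {i j : Fin p} → toℕ i ≈ toℕ j → i ≡ j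
  ≈⇒≡ {i} {j} (mk≈ e) = toℕ-injective (begin
      toℕ i      ≡⟨ m<n⇒m%n≡m (toℕ<n i) ⟨
      toℕ i % p  ≡⟨ e ⟩
      toℕ j % p  ≡⟨ m<n⇒m%n≡m (toℕ<n j) ⟩
      toℕ j      ∎)
    where open ≡-Reasoning

  toℕ-mod : ∀ x → toℕ (x mod p) ≈ x
  toℕ-mod x = begin
    toℕ (x mod p)  ≡⟨ toℕ-fromℕ< (m%n<n x p) ⟩
    x % p          ≈⟨ %-≈ x ⟩
    x              ∎
    where open ≈-Reasoning

  x+[p∸x]≈0 : ∀ {x} → x ≤ p → x + (p ∸ x) ≈ 0
  x+[p∸x]≈0 x≤p = ≈-trans (≈-reflexive (ℕ.m+[n∸m]≡n x≤p)) p≈0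

  -_ : ℕ → ℕ
  - x = p ∸ x % p

  +-inverseʳ : ∀ x → x + - x ≈ 0
  +-inverseʳ x = begin
    x + - x        ≈⟨ +-congʳ (- x) (%-≈ x) ⟨
    x % p + - x    ≈⟨ x+[p∸x]≈0 (ℕ.<⇒≤ (m%n<n x p)) ⟩
    0              ∎
    where open ≈-Reasoning

  +-inverseˡ : ∀ x → - x + x ≈ 0
  +-inverseˡ x = ≈-trans (≈-reflexive (ℕ.+-comm (- x) x)) (+-inverseʳ x)

  +-cancelʳ : ∀ {a x y} → x + a ≈ y + a → x ≈ y
  +-cancelʳ {a} {x} {y} x+a≈y+a = begin
    x                ≡⟨ ℕ.+-identityʳ x ⟨
    x + 0            ≈⟨ +-congˡ x (+-inverseʳ a) ⟨
    x + (a + - a)    ≡⟨ ℕ.+-assoc x a (- a) ⟨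
    (x + a) + - a    ≈⟨ +-congʳ (- a) x+a≈y+a ⟩
    (y + a) + - a    ≡⟨ ℕ.+-assoc y a (- a) ⟩
    y + (a + - a)    ≈⟨ +-congˡ y (+-inverseʳ a) ⟩
    y + 0            ≡⟨ ℕ.+-identityʳ y ⟩
    y                ∎
    where open ≈-Reasoning

  toℕ-mod-< : ∀ {x} → x < p → toℕ (x mod p) ≡ x
  toℕ-mod-< {x} x<p = trans (toℕ-fromℕ< (m%n<n x p)) (m<n⇒m%n≡m x<p)

  toℕ-mod-toℕ : ∀ i → toℕ i mod p ≡ i
  toℕ-mod-toℕ i = toℕ-injective (toℕ-mod-< (toℕ<n i))

  p-mod-p : p mod p ≡ Fin.zero
  p-mod-p = ≈⇒≡ (≈-trans (toℕ-mod p) p≈0)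

  translate : ℕ → Fin p → Fin p
  translate c i = (c + toℕ i) mod p

  reflect : ℕ → Fin p → Fin p
  reflect c i = (c + (p ∸ toℕ i)) mod p

  translate-inverse : ∀ c d → c + d ≈ 0 → ∀ i → translate c (translate d i) ≡ i
  translate-inverse c d c+d≈0 i = ≈⇒≡ (begin
    toℕ (translate c (translate d i))  ≈⟨ toℕ-mod (c + toℕ (translate d i)) ⟩
    c + toℕ (translate d i)            ≈⟨ +-congˡ c (toℕ-mod (d + toℕ i)) ⟩
    c + (d + toℕ i)                    ≡⟨ ℕ.+-assoc c d (toℕ i) ⟨
    (c + d) + toℕ i                    ≈⟨ +-congʳ (toℕ i) c+d≈0 ⟩
    toℕ i                              ∎)
    where open ≈-Reasoning

  reflect-+ : ∀ c i → toℕ (reflect c i) + toℕ i ≈ c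
  reflect-+ c i = begin
    toℕ (reflect c i) + toℕ i    ≈⟨ +-congʳ (toℕ i) (toℕ-mod (c + (p ∸ toℕ i))) ⟩
    c + (p ∸ toℕ i) + toℕ i      ≡⟨ ℕ.+-assoc c (p ∸ toℕ i) (toℕ i) ⟩
    c + (p ∸ toℕ i + toℕ i)      ≡⟨ cong (c +_) (ℕ.m∸n+n≡m (ℕ.<⇒≤ (toℕ<n i))) ⟩
    c + p                        ≈⟨ +-congˡ c p≈0 ⟩
    c + 0                        ≡⟨ ℕ.+-identityʳ c ⟩
    c                            ∎
    where open ≈-Reasoning

  reflect-involutive : ∀ c i → reflect c (reflect c i) ≡ i
  reflect-involutive c i = ≈⇒≡ (+-cancelʳ (begin
    toℕ (reflect c j) + toℕ j   ≈⟨ reflect-+ c j ⟩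
    c                           ≈⟨ reflect-+ c i ⟨
    toℕ j + toℕ i               ≡⟨ ℕ.+-comm (toℕ j) (toℕ i) ⟩
    toℕ i + toℕ j               ∎))
    where open ≈-Reasoning
          j = reflect c i

  translate↔ : ℕ → Permutation′ p
  translate↔ c = permutation (translate c) (translate (- c))
    (translate-inverse c (- c) (+-inverseʳ c)) (translate-inverse (- c) c (+-inverseˡ c))

  reflect↔ : ℕ → Permutation′ p
  reflect↔ c = permutation (reflect c) (reflect c) (reflect-involutive c) (reflect-involutive c)

  translate-by-negative : ∀ i j → translate (toℕ ((p ∸ toℕ i) mod p)) j ≡ reflect (toℕ j) i
  translate-by-negative i j = ≈⇒≡ (begin
    toℕ (translate (toℕ ((p ∸ toℕ i) mod p)) j)  ≈⟨ toℕ-mod (toℕ ((p ∸ toℕ i) mod p) + toℕ j) ⟩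
    toℕ ((p ∸ toℕ i) mod p) + toℕ j              ≈⟨ +-congʳ (toℕ j) (toℕ-mod (p ∸ toℕ i)) ⟩
    (p ∸ toℕ i) + toℕ j                          ≡⟨ ℕ.+-comm (p ∸ toℕ i) (toℕ j) ⟩
    toℕ j + (p ∸ toℕ i)                          ≈⟨ toℕ-mod (toℕ j + (p ∸ toℕ i)) ⟨
    toℕ (reflect (toℕ j) i)                      ∎)
    where open ≈-Reasoning

module OrderedField (R : RealField) where

  open RealField R public renaming (+-mono-≤ to +-monoˡ-≤)

  commutativeRing : CommutativeRing 0ℓ 0ℓ
  commutativeRing = record { isCommutativeRing = isCommutativeRing }

  open CommutativeRing commutativeRing public
    using (ring; +-assoc; +-comm; +-identityˡ; +-identityʳ; -‿inverseˡ; -‿inverseʳ;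
           *-assoc; *-comm; *-identityˡ; distribʳ; zeroˡ; zeroʳ)
  open import Algebra.Properties.Ring ring public
    using (-‿involutive; -‿distribˡ-*; -‿distribʳ-*; -0#≈0#; -‿anti-homo-+; x∙y⁻¹≈ε⇒x≈y)

  totalOrder : TotalOrder 0ℓ 0ℓ 0ℓ
  totalOrder = record { isTotalOrder = isTotalOrder }

  open TotalOrder totalOrder public
    using (poset; total; antisym) renaming (refl to ≤-refl; reflexive to ≤-reflexive; trans to ≤-trans)

  module ≤-Reasoning = Relation.Binary.Reasoning.PartialOrder poset

  infixl 6 _-_
  _-_ : Carrier → Carrier → Carrier
  x - y = x + - y

  +-monoʳ-≤ : ∀ z {x y} → x ≤ y → z + x ≤ z + y
  +-monoʳ-≤ z {x} {y} x≤y = subst₂ _≤_ (+-comm x z) (+-comm y z) (+-monoˡ-≤ z x≤y)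

  +-mono-≤ : ∀ {x y u v} → x ≤ y → u ≤ v → x + u ≤ y + v
  +-mono-≤ {y = y} {u = u} x≤y u≤v = ≤-trans (+-monoˡ-≤ u x≤y) (+-monoʳ-≤ y u≤v)

  x≤y⇒0≤y-x : ∀ {x y} → x ≤ y → 0# ≤ y - x
  x≤y⇒0≤y-x {x} x≤y = subst (_≤ _) (-‿inverseʳ x) (+-monoˡ-≤ (- x) x≤y)

  0≤y-x⇒x≤y : ∀ {x y} → 0# ≤ y - x → x ≤ y
  0≤y-x⇒x≤y {x} {y} 0≤y-x = subst₂ _≤_ (+-identityˡ x) y-x+x≡y (+-monoˡ-≤ x 0≤y-x)
    where
    y-x+x≡y : y - x + x ≡ y
    y-x+x≡y = trans (+-assoc y (- x) x) (trans (cong (y +_) (-‿inverseˡ x)) (+-identityʳ y))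

  neg-antimono-≤ : ∀ {x y} → x ≤ y → - y ≤ - x
  neg-antimono-≤ {x} {y} x≤y = 0≤y-x⇒x≤y (subst (0# ≤_) y-x≡-x--y (x≤y⇒0≤y-x x≤y))
    where
    y-x≡-x--y : y - x ≡ - x - - y
    y-x≡-x--y = trans (+-comm y (- x)) (cong (- x +_) (sym (-‿involutive y)))

  x≤0⇒0≤-x : ∀ {x} → x ≤ 0# → 0# ≤ - x
  x≤0⇒0≤-x x≤0 = subst (_≤ _) -0#≈0# (neg-antimono-≤ x≤0)

  0≤x⇒-x≤0 : ∀ {x} → 0# ≤ x → - x ≤ 0#
  0≤x⇒-x≤0 0≤x = subst (_ ≤_) -0#≈0# (neg-antimono-≤ 0≤x)

  *-monoʳ-≤ : ∀ {x y z} → 0# ≤ z → x ≤ y → x * z ≤ y * z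
  *-monoʳ-≤ {x} {y} {z} 0≤z x≤y = 0≤y-x⇒x≤y (subst (0# ≤_) [y-x]z≡yz-xz (*-nonneg (x≤y⇒0≤y-x x≤y) 0≤z))
    where
    [y-x]z≡yz-xz : (y - x) * z ≡ y * z - x * z
    [y-x]z≡yz-xz = trans (distribʳ z y (- x)) (cong (y * z +_) (sym (-‿distribˡ-* x z)))

  *-monoˡ-≤ : ∀ {x y z} → 0# ≤ z → x ≤ y → z * x ≤ z * y
  *-monoˡ-≤ {x} {y} {z} 0≤z x≤y = subst₂ _≤_ (*-comm x z) (*-comm y z) (*-monoʳ-≤ 0≤z x≤y)

  -x*-x≡x*x : ∀ x → - x * - x ≡ x * x
  -x*-x≡x*x x = trans (sym (-‿distribˡ-* x (- x))) (trans (cong -_ (sym (-‿distribʳ-* x x))) (-‿involutive _))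

  0≤x*x : ∀ x → 0# ≤ x * x
  0≤x*x x with total 0# x
  ... | inj₁ 0≤x = *-nonneg 0≤x 0≤x
  ... | inj₂ x≤0 = subst (0# ≤_) (-x*-x≡x*x x) (*-nonneg (x≤0⇒0≤-x x≤0) (x≤0⇒0≤-x x≤0))

  0≤1 : 0# ≤ 1#
  0≤1 = subst (0# ≤_) (*-identityˡ 1#) (0≤x*x 1#)

  x*x≤y*y : ∀ {x y} → 0# ≤ x → x ≤ y → x * x ≤ y * y
  x*x≤y*y 0≤x x≤y = ≤-trans (*-monoʳ-≤ 0≤x x≤y) (*-monoˡ-≤ (≤-trans 0≤x x≤y) x≤y)

  x≢0∧x*y≡0⇒y≡0 : ∀ {x y} → x ≢ 0# → x * y ≡ 0# → y ≡ 0#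
  x≢0∧x*y≡0⇒y≡0 {x} {y} x≢0 x*y≡0 with *-inverse x x≢0
  ... | x⁻¹ , x*x⁻¹≡1 = begin
    y              ≡⟨ *-identityˡ y ⟨
    1# * y         ≡⟨ cong (_* y) (trans (sym x*x⁻¹≡1) (*-comm x x⁻¹)) ⟩
    x⁻¹ * x * y    ≡⟨ *-assoc x⁻¹ x y ⟩
    x⁻¹ * (x * y)  ≡⟨ cong (x⁻¹ *_) x*y≡0 ⟩
    x⁻¹ * 0#       ≡⟨ zeroʳ x⁻¹ ⟩
    0#             ∎
    where open ≡-Reasoning

  xz≡yz⇒[x-y]z≡0 : ∀ {x y z} → x * z ≡ y * z → (x - y) * z ≡ 0#
  xz≡yz⇒[x-y]z≡0 {x} {y} {z} xz≡yz = begin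
    (x - y) * z      ≡⟨ distribʳ z x (- y) ⟩
    x * z + - y * z  ≡⟨ cong₂ _+_ xz≡yz (sym (-‿distribˡ-* y z)) ⟩
    y * z - y * z    ≡⟨ -‿inverseʳ (y * z) ⟩
    0#               ∎
    where open ≡-Reasoning

  xz≡yz∧x≢y⇒z≡0 : ∀ {x y z} → x * z ≡ y * z → x ≢ y → z ≡ 0#
  xz≡yz∧x≢y⇒z≡0 {x} {y} xz≡yz x≢y =
    x≢0∧x*y≡0⇒y≡0 (x≢y ∘ x∙y⁻¹≈ε⇒x≈y x y) (xz≡yz⇒[x-y]z≡0 xz≡yz)

  *-cancelʳ-≡ : ∀ {x y z} → z ≢ 0# → x * z ≡ y * z → x ≡ y
  *-cancelʳ-≡ {x} {y} {z} z≢0 xz≡yz =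
    x∙y⁻¹≈ε⇒x≈y x y (x≢0∧x*y≡0⇒y≡0 z≢0 (trans (*-comm z (x - y)) (xz≡yz⇒[x-y]z≡0 xz≡yz)))

  *-cancelʳ-≤ : ∀ {x y z} → 0# ≤ z → z ≢ 0# → x * z ≤ y * z → x ≤ y
  *-cancelʳ-≤ {x} {y} 0≤z z≢0 xz≤yz with total x y
  ... | inj₁ x≤y = x≤y
  ... | inj₂ y≤x = ≤-reflexive (*-cancelʳ-≡ z≢0 (antisym xz≤yz (*-monoʳ-≤ 0≤z y≤x)))

  infix 4 _≡±_
  _≡±_ : Carrier → Carrier → Set
  x ≡± y = x ≡ y ⊎ x ≡ - y

  ≡±-sym : ∀ {x y} → x ≡± y → y ≡± x
  ≡±-sym (inj₁ x≡y)  = inj₁ (sym x≡y)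
  ≡±-sym (inj₂ x≡-y) = inj₂ (trans (sym (-‿involutive _)) (cong -_ (sym x≡-y)))

  ≡±-trans : ∀ {x y z} → x ≡± y → y ≡± z → x ≡± z
  ≡±-trans (inj₁ x≡y)  (inj₁ y≡z)  = inj₁ (trans x≡y y≡z)
  ≡±-trans (inj₁ x≡y)  (inj₂ y≡-z) = inj₂ (trans x≡y y≡-z)
  ≡±-trans (inj₂ x≡-y) (inj₁ y≡z)  = inj₂ (trans x≡-y (cong -_ y≡z))
  ≡±-trans (inj₂ x≡-y) (inj₂ y≡-z) = inj₁ (trans x≡-y (trans (cong -_ y≡-z) (-‿involutive _)))

  ≡±-* : ∀ {x y u v} → x ≡± y → u ≡± v → x * u ≡± y * v
  ≡±-* (inj₁ refl) (inj₁ refl) = inj₁ refl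
  ≡±-* {y = y} {v = v} (inj₁ refl) (inj₂ refl) = inj₂ (sym (-‿distribʳ-* y v))
  ≡±-* {y = y} {v = v} (inj₂ refl) (inj₁ refl) = inj₂ (sym (-‿distribˡ-* y v))
  ≡±-* {y = y} {v = v} (inj₂ refl) (inj₂ refl) = inj₁ (begin
    - y * - v    ≡⟨ -‿distribˡ-* y (- v) ⟨
    - (y * - v)  ≡⟨ cong -_ (-‿distribʳ-* y v) ⟨
    - - (y * v)  ≡⟨ -‿involutive (y * v) ⟩
    y * v        ∎)
    where open ≡-Reasoning

  ≡±∧0≤⇒≡ : ∀ {x y} → 0# ≤ x → 0# ≤ y → x ≡± y → x ≡ y
  ≡±∧0≤⇒≡ 0≤x 0≤y (inj₁ x≡y) = x≡y
  ≡±∧0≤⇒≡ {x} {y} 0≤x 0≤y (inj₂ x≡-y) = trans x≡-y (trans (cong -_ y≡0) (trans -0#≈0# (sym y≡0)))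
    where
    y≡0 : y ≡ 0#
    y≡0 = antisym (subst (_≤ 0#) (-‿involutive y) (0≤x⇒-x≤0 (subst (0# ≤_) x≡-y 0≤x))) 0≤y

  ∣_∣ : Carrier → Carrier
  ∣ x ∣ with total 0# x
  ... | inj₁ _ = x
  ... | inj₂ _ = - x

  ∣x∣≡±x : ∀ x → ∣ x ∣ ≡± x
  ∣x∣≡±x x with total 0# x
  ... | inj₁ _ = inj₁ refl
  ... | inj₂ _ = inj₂ refl

  0≤∣x∣ : ∀ x → 0# ≤ ∣ x ∣
  0≤∣x∣ x with total 0# x
  ... | inj₁ 0≤x = 0≤x
  ... | inj₂ x≤0 = x≤0⇒0≤-x x≤0

  x≤∣x∣ : ∀ x → x ≤ ∣ x ∣
  x≤∣x∣ x with total 0# x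
  ... | inj₁ _   = ≤-refl
  ... | inj₂ x≤0 = ≤-trans x≤0 (x≤0⇒0≤-x x≤0)

  -x≤∣x∣ : ∀ x → - x ≤ ∣ x ∣
  -x≤∣x∣ x with total 0# x
  ... | inj₁ 0≤x = ≤-trans (0≤x⇒-x≤0 0≤x) 0≤x
  ... | inj₂ _   = ≤-refl

  ∣-∣-cong-≡± : ∀ {x y} → x ≡± y → ∣ x ∣ ≡ ∣ y ∣
  ∣-∣-cong-≡± {x} {y} x≡±y = ≡±∧0≤⇒≡ (0≤∣x∣ x) (0≤∣x∣ y)
    (≡±-trans (∣x∣≡±x x) (≡±-trans x≡±y (≡±-sym (∣x∣≡±x y))))

  ∣-x∣≡∣x∣ : ∀ x → ∣ - x ∣ ≡ ∣ x ∣
  ∣-x∣≡∣x∣ x = ∣-∣-cong-≡± (inj₂ refl)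

  ∣x*y∣≡∣x∣*∣y∣ : ∀ x y → ∣ x * y ∣ ≡ ∣ x ∣ * ∣ y ∣
  ∣x*y∣≡∣x∣*∣y∣ x y = ≡±∧0≤⇒≡ (0≤∣x∣ (x * y)) (*-nonneg (0≤∣x∣ x) (0≤∣x∣ y))
    (≡±-trans (∣x∣≡±x (x * y)) (≡±-sym (≡±-* (∣x∣≡±x x) (∣x∣≡±x y))))

  0≤x⇒∣x∣≡x : ∀ {x} → 0# ≤ x → ∣ x ∣ ≡ x
  0≤x⇒∣x∣≡x {x} 0≤x = ≡±∧0≤⇒≡ (0≤∣x∣ x) 0≤x (∣x∣≡±x x)

  ∣x+y∣≤∣x∣+∣y∣ : ∀ x y → ∣ x + y ∣ ≤ ∣ x ∣ + ∣ y ∣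
  ∣x+y∣≤∣x∣+∣y∣ x y with ∣x∣≡±x (x + y)
  ... | inj₁ ∣x+y∣≡x+y  = subst (_≤ ∣ x ∣ + ∣ y ∣) (sym ∣x+y∣≡x+y) (+-mono-≤ (x≤∣x∣ x) (x≤∣x∣ y))
  ... | inj₂ ∣x+y∣≡-x+y = subst (_≤ ∣ x ∣ + ∣ y ∣) (sym ∣x+y∣≡-x+-y) (+-mono-≤ (-x≤∣x∣ x) (-x≤∣x∣ y))
    where
    ∣x+y∣≡-x+-y : ∣ x + y ∣ ≡ - x + - y
    ∣x+y∣≡-x+-y = trans ∣x+y∣≡-x+y (trans (-‿anti-homo-+ x y) (+-comm (- y) (- x)))

  x*x≡∣x∣*∣x∣ : ∀ x → x * x ≡ ∣ x ∣ * ∣ x ∣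
  x*x≡∣x∣*∣x∣ x with ∣x∣≡±x x
  ... | inj₁ ∣x∣≡x  = cong₂ _*_ (sym ∣x∣≡x) (sym ∣x∣≡x)
  ... | inj₂ ∣x∣≡-x = trans (sym (-x*-x≡x*x x)) (cong₂ _*_ (sym ∣x∣≡-x) (sym ∣x∣≡-x))

  ∣x∣≡0⇒x≡0 : ∀ {x} → ∣ x ∣ ≡ 0# → x ≡ 0#
  ∣x∣≡0⇒x≡0 {x} ∣x∣≡0 with ≡±-sym (∣x∣≡±x x)
  ... | inj₁ x≡∣x∣  = trans x≡∣x∣ ∣x∣≡0
  ... | inj₂ x≡-∣x∣ = trans x≡-∣x∣ (trans (cong -_ ∣x∣≡0) -0#≈0#)

  fromℕ-+ : ∀ m n → fromℕ (m ℕ.+ n) ≡ fromℕ m + fromℕ n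
  fromℕ-+ zero    n = sym (+-identityˡ (fromℕ n))
  fromℕ-+ (suc m) n = trans (cong (1# +_) (fromℕ-+ m n)) (sym (+-assoc 1# (fromℕ m) (fromℕ n)))

  fromℕ-* : ∀ m n → fromℕ (m ℕ.* n) ≡ fromℕ m * fromℕ n
  fromℕ-* zero    n = sym (zeroˡ (fromℕ n))
  fromℕ-* (suc m) n = begin
    fromℕ (n ℕ.+ m ℕ.* n)              ≡⟨ fromℕ-+ n (m ℕ.* n) ⟩
    fromℕ n + fromℕ (m ℕ.* n)          ≡⟨ cong₂ _+_ (sym (*-identityˡ (fromℕ n))) (fromℕ-* m n) ⟩
    1# * fromℕ n + fromℕ m * fromℕ n   ≡⟨ distribʳ (fromℕ n) 1# (fromℕ m) ⟨
    (1# + fromℕ m) * fromℕ n           ∎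
    where open ≡-Reasoning

  0≤fromℕ : ∀ m → 0# ≤ fromℕ m
  0≤fromℕ zero    = ≤-refl
  0≤fromℕ (suc m) = subst (_≤ fromℕ (suc m)) (+-identityˡ 0#) (+-mono-≤ 0≤1 (0≤fromℕ m))

  fromℕ-mono-≤ : ∀ {m n} → m ℕ.≤ n → fromℕ m ≤ fromℕ n
  fromℕ-mono-≤ {m} {n} m≤n = subst₂ _≤_ (+-identityʳ (fromℕ m)) fromℕm+fromℕ[n∸m]≡fromℕn
    (+-monoʳ-≤ (fromℕ m) (0≤fromℕ (n ℕ.∸ m)))
    where
    fromℕm+fromℕ[n∸m]≡fromℕn : fromℕ m + fromℕ (n ℕ.∸ m) ≡ fromℕ n
    fromℕm+fromℕ[n∸m]≡fromℕn = trans (sym (fromℕ-+ m (n ℕ.∸ m))) (cong fromℕ (ℕ.m+[n∸m]≡n m≤n))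

  private variable A B : Set

  ∑ : List A → (A → Carrier) → Carrier
  ∑ xs φ = sumR (map φ xs)

  infix 7 ∑
  syntax ∑ xs (λ x → e) = ∑[ x ∈ xs ] e

  ∑-cong : ∀ (xs : List A) {φ ψ} → (∀ x → φ x ≡ ψ x) → ∑ xs φ ≡ ∑ xs ψ
  ∑-cong []       φ≗ψ = refl
  ∑-cong (x ∷ xs) φ≗ψ = cong₂ _+_ (φ≗ψ x) (∑-cong xs φ≗ψ)

  ∑-++ : ∀ (xs ys : List A) φ → ∑ (xs ++ ys) φ ≡ ∑ xs φ + ∑ ys φ
  ∑-++ []       ys φ = sym (+-identityˡ _)
  ∑-++ (x ∷ xs) ys φ = trans (cong (φ x +_) (∑-++ xs ys φ)) (sym (+-assoc (φ x) _ _))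

  ∑-0 : ∀ (xs : List A) → ∑[ x ∈ xs ] 0# ≡ 0#
  ∑-0 []       = refl
  ∑-0 (x ∷ xs) = trans (+-identityˡ _) (∑-0 xs)

  ∑-+ : ∀ (xs : List A) φ ψ → ∑[ x ∈ xs ] (φ x + ψ x) ≡ ∑ xs φ + ∑ xs ψ
  ∑-+ []       φ ψ = sym (+-identityˡ 0#)
  ∑-+ (x ∷ xs) φ ψ = trans (cong (φ x + ψ x +_) (∑-+ xs φ ψ)) (interchange (φ x) (ψ x) _ _)
    where open import Algebra.Properties.CommutativeSemigroup
                 (CommutativeRing.+-commutativeSemigroup commutativeRing) using (interchange)

  ∑-*ʳ : ∀ (xs : List A) φ c → ∑[ x ∈ xs ] (φ x * c) ≡ ∑ xs φ * c
  ∑-*ʳ []       φ c = sym (zeroˡ c)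
  ∑-*ʳ (x ∷ xs) φ c = trans (cong (φ x * c +_) (∑-*ʳ xs φ c)) (sym (distribʳ c (φ x) _))

  ∑-*ˡ : ∀ (xs : List A) φ c → ∑[ x ∈ xs ] (c * φ x) ≡ c * ∑ xs φ
  ∑-*ˡ xs φ c = trans (∑-cong xs (λ x → *-comm c (φ x))) (trans (∑-*ʳ xs φ c) (*-comm _ c))

  ∑-mono-≤ : ∀ (xs : List A) {φ ψ} → (∀ x → φ x ≤ ψ x) → ∑ xs φ ≤ ∑ xs ψ
  ∑-mono-≤ []       φ≤ψ = ≤-refl
  ∑-mono-≤ (x ∷ xs) φ≤ψ = +-mono-≤ (φ≤ψ x) (∑-mono-≤ xs φ≤ψ)

  ∣∑∣≤∑∣∣ : ∀ (xs : List A) φ → ∣ ∑ xs φ ∣ ≤ ∑[ x ∈ xs ] ∣ φ x ∣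
  ∣∑∣≤∑∣∣ []       φ = ≤-reflexive (0≤x⇒∣x∣≡x ≤-refl)
  ∣∑∣≤∑∣∣ (x ∷ xs) φ = ≤-trans (∣x+y∣≤∣x∣+∣y∣ (φ x) _) (+-monoʳ-≤ ∣ φ x ∣ (∣∑∣≤∑∣∣ xs φ))

  ∑-comm : ∀ (xs : List A) (ys : List B) (f : A → B → Carrier) →
           ∑[ x ∈ xs ] ∑[ y ∈ ys ] f x y ≡ ∑[ y ∈ ys ] ∑[ x ∈ xs ] f x y
  ∑-comm []       ys f = sym (∑-0 ys)
  ∑-comm (x ∷ xs) ys f = trans (cong (∑ ys (f x) +_) (∑-comm xs ys f)) (sym (∑-+ ys (f x) _))

  open import Algebra.Properties.CommutativeMonoid.Sum (CommutativeRing.+-commutativeMonoid commutativeRing) public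
    using (sum; sum-permute; sum-cong-≗)

  ∑-tabulate : ∀ {m} (f : Fin m → A) (φ : A → Carrier) → ∑[ x ∈ tabulate f ] φ x ≡ sum (φ ∘ f)
  ∑-tabulate {m = zero}  f φ = refl
  ∑-tabulate {m = suc m} f φ = cong (φ (f Fin.zero) +_) (∑-tabulate (f ∘ Fin.suc) φ)

  ind : Bool → Carrier
  ind b = if b then 1# else 0#

  0≤ind : ∀ b → 0# ≤ ind b
  0≤ind true  = 0≤1
  0≤ind false = ≤-refl

  ind+ind-not≡1 : ∀ b → ind b + ind (not b) ≡ 1#
  ind+ind-not≡1 true  = +-identityʳ 1#
  ind+ind-not≡1 false = +-identityˡ 1#

  fromℕ-count : ∀ (P : A → Bool) (xs : List A) → fromℕ (count P xs) ≡ ∑[ x ∈ xs ] ind (P x)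
  fromℕ-count P []       = refl
  fromℕ-count P (x ∷ xs) with P x
  ... | true  = cong (1# +_) (fromℕ-count P xs)
  ... | false = trans (fromℕ-count P xs) (sym (+-identityˡ _))

  weighted-sum-bound : ∀ (xs : List A) {w v : A → Carrier} {M} → (∀ x → 0# ≤ w x) → (∀ x → ∣ v x ∣ ≤ M) →
                       ∣ ∑[ x ∈ xs ] (w x * v x) ∣ ≤ ∑ xs w * M
  weighted-sum-bound xs {w} {v} {M} 0≤w ∣v∣≤M = begin
    ∣ ∑[ x ∈ xs ] (w x * v x) ∣    ≤⟨ ∣∑∣≤∑∣∣ xs (λ x → w x * v x) ⟩
    ∑[ x ∈ xs ] ∣ w x * v x ∣      ≡⟨ ∑-cong xs ∣wv∣≡w∣v∣ ⟩
    ∑[ x ∈ xs ] (w x * ∣ v x ∣)    ≤⟨ ∑-mono-≤ xs (λ x → *-monoˡ-≤ (0≤w x) (∣v∣≤M x)) ⟩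
    ∑[ x ∈ xs ] (w x * M)          ≡⟨ ∑-*ʳ xs w M ⟩
    ∑ xs w * M                     ∎
    where
    open ≤-Reasoning
    ∣wv∣≡w∣v∣ : ∀ x → ∣ w x * v x ∣ ≡ w x * ∣ v x ∣
    ∣wv∣≡w∣v∣ x = trans (∣x*y∣≡∣x∣*∣y∣ (w x) (v x)) (cong (_* ∣ v x ∣) (0≤x⇒∣x∣≡x (0≤w x)))

-- Eigenvalues of 0/1 matrices with constant line sums

module ZeroOneMatrix (R : RealField) {X : Set} (xs : List X) (xs-complete : ∀ x → x ∈ xs)
                     (P : X → X → Bool) where

  open OrderedField R
  open import Algebra.Properties.Ring ring using (+-inverseˡ-unique)
  open import Data.List.Extrema totalOrder using (argmax; f[xs]≤f[argmax])

  IsEigenpair : Carrier → (X → Carrier) → Set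
  IsEigenpair λ′ v = ∀ g → ∑[ h ∈ xs ] (ind (P g h) * v h) ≡ λ′ * v g

  maximum : (f : X → Carrier) → X → Σ X λ m → ∀ x → f x ≤ f m
  maximum f x₀ = argmax f x₀ xs , λ x → All.lookup (f[xs]≤f[argmax] x₀ xs) (xs-complete x)

  module _ {λ′ : Carrier} {v : X → Carrier} (eigen : IsEigenpair λ′ v) where

    eigenvector-sum-zero : ∀ {k} → (∀ h → ∑[ g ∈ xs ] ind (P g h) ≡ k) → λ′ ≢ k → ∑ xs v ≡ 0#
    eigenvector-sum-zero {k} column-sum λ′≢k = xz≡yz∧x≢y⇒z≡0 λ′Σv≡kΣv λ′≢k
      where
      open ≡-Reasoning
      λ′Σv≡kΣv : λ′ * ∑ xs v ≡ k * ∑ xs v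
      λ′Σv≡kΣv = begin
        λ′ * ∑ xs v
          ≡⟨ ∑-*ˡ xs v λ′ ⟨
        ∑[ g ∈ xs ] (λ′ * v g)
          ≡⟨ ∑-cong xs (sym ∘ eigen) ⟩
        ∑[ g ∈ xs ] ∑[ h ∈ xs ] (ind (P g h) * v h)
          ≡⟨ ∑-comm xs xs (λ g h → ind (P g h) * v h) ⟩
        ∑[ h ∈ xs ] ∑[ g ∈ xs ] (ind (P g h) * v h)
          ≡⟨ ∑-cong xs (λ h → ∑-*ʳ xs (λ g → ind (P g h)) (v h)) ⟩
        ∑[ h ∈ xs ] ((∑[ g ∈ xs ] ind (P g h)) * v h)
          ≡⟨ ∑-cong xs (λ h → cong (_* v h) (column-sum h)) ⟩
        ∑[ h ∈ xs ] (k * v h)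
          ≡⟨ ∑-*ˡ xs v k ⟩
        k * ∑ xs v
          ∎

    complement-eigen : ∑ xs v ≡ 0# → ∀ g → λ′ * v g ≡ - (∑[ h ∈ xs ] (ind (not (P g h)) * v h))
    complement-eigen Σv≡0 g = trans (sym (eigen g)) (+-inverseˡ-unique _ _ (begin
      ∑[ h ∈ xs ] (ind (P g h) * v h) + ∑[ h ∈ xs ] (ind (not (P g h)) * v h)
        ≡⟨ ∑-+ xs _ _ ⟨
      ∑[ h ∈ xs ] (ind (P g h) * v h + ind (not (P g h)) * v h)
        ≡⟨ ∑-cong xs (λ h → distribʳ (v h) _ _) ⟨
      ∑[ h ∈ xs ] ((ind (P g h) + ind (not (P g h))) * v h)
        ≡⟨ ∑-cong xs (λ h → cong (_* v h) (ind+ind-not≡1 (P g h))) ⟩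
      ∑[ h ∈ xs ] (1# * v h)
        ≡⟨ ∑-cong xs (λ h → *-identityˡ (v h)) ⟩
      ∑ xs v
        ≡⟨ Σv≡0 ⟩
      0#
        ∎))
      where open ≡-Reasoning

    eigenvalue-bound : ∀ {k k′} → (∀ h → ∑[ g ∈ xs ] ind (P g h) ≡ k) →
                       (∀ g → ∑[ h ∈ xs ] ind (not (P g h)) ≡ k′) →
                       ∃[ g ] v g ≢ 0# → λ′ ≢ k → ∣ λ′ ∣ ≤ k′
    eigenvalue-bound {k} {k′} column-sum complement-row-sum (g₀ , vg₀≢0) λ′≢k =
      *-cancelʳ-≤ (0≤∣x∣ (v g*)) M≢0 ∣λ′∣M≤k′M
      where
      g* = proj₁ (maximum (∣_∣ ∘ v) g₀)
      M  = ∣ v g* ∣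
      ∣v∣≤M : ∀ h → ∣ v h ∣ ≤ M
      ∣v∣≤M = proj₂ (maximum (∣_∣ ∘ v) g₀)
      M≢0 : M ≢ 0#
      M≢0 M≡0 = vg₀≢0 (∣x∣≡0⇒x≡0 (antisym (≤-trans (∣v∣≤M g₀) (≤-reflexive M≡0)) (0≤∣x∣ (v g₀))))
      ∣λ′∣M≤k′M : ∣ λ′ ∣ * M ≤ k′ * M
      ∣λ′∣M≤k′M = begin
        ∣ λ′ ∣ * M
          ≡⟨ ∣x*y∣≡∣x∣*∣y∣ λ′ (v g*) ⟨
        ∣ λ′ * v g* ∣
          ≡⟨ cong ∣_∣ (complement-eigen (eigenvector-sum-zero column-sum λ′≢k) g*) ⟩
        ∣ - (∑[ h ∈ xs ] (ind (not (P g* h)) * v h)) ∣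
          ≡⟨ ∣-x∣≡∣x∣ _ ⟩
        ∣ ∑[ h ∈ xs ] (ind (not (P g* h)) * v h) ∣
          ≤⟨ weighted-sum-bound xs (λ h → 0≤ind (not (P g* h))) ∣v∣≤M ⟩
        (∑[ h ∈ xs ] ind (not (P g* h))) * M
          ≡⟨ cong (_* M) (complement-row-sum g*) ⟩
        k′ * M
          ∎
        where open ≤-Reasoning

-- Cayley graphs of the dihedral group

module DihedralElements (n : ℕ) where

  open Modular n using (p)
  open Dihedral p
  open import Data.List.Membership.Propositional.Properties using (∈-map⁺; ∈-++⁺ˡ; ∈-++⁺ʳ; ∈-allFin)
  open import Data.List.Properties using (length-map; length-tabulate)

  rotation reflection : Fin p → D
  rotation   i = false , i
  reflection i = true , i

  ∈-elements : ∀ g → g ∈ elements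
  ∈-elements (false , i) = ∈-++⁺ˡ {ys = map reflection (allFin p)} (∈-map⁺ rotation (∈-allFin i))
  ∈-elements (true  , i) = ∈-++⁺ʳ (map rotation (allFin p)) (∈-map⁺ reflection (∈-allFin i))

  length-elements : length elements ≡ 2 ℕ.* p
  length-elements = begin
    length elements                  ≡⟨ length-++ (map rotation (allFin p)) {map reflection (allFin p)} ⟩
    length (map rotation (allFin p)) ℕ.+ length (map reflection (allFin p))
                                     ≡⟨ cong₂ ℕ._+_ (length-map-allFin rotation) (length-map-allFin reflection) ⟩
    p ℕ.+ p                          ≡⟨ cong (p ℕ.+_) (ℕ.+-identityʳ p) ⟨
    2 ℕ.* p                          ∎
    where
    open ≡-Reasoning
    length-map-allFin : (f : Fin p → D) → length (map f (allFin p)) ≡ p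
    length-map-allFin f = trans (length-map f (allFin p)) (length-tabulate (λ i → i))

  card-complement : ∀ S → card S ℕ.+ card (not ∘ S) ≡ 2 ℕ.* p
  card-complement S = trans (count-complement S elements) length-elements

  card≤2p : ∀ S → card S ℕ.≤ 2 ℕ.* p
  card≤2p S = subst (card S ℕ.≤_) (card-complement S) (ℕ.m≤m+n (card S) (card (not ∘ S)))

module DihedralCayleyGraph (R : RealField) (n : ℕ) where

  open Modular n using (p; translate; translate↔; reflect↔; translate-by-negative)
  open Dihedral p
  open DihedralElements n
  open OrderedField R
  open import Data.Fin.Permutation using (_⟨$⟩ʳ_)

  ∑-elements : ∀ φ → ∑ elements φ ≡ sum (φ ∘ rotation) + sum (φ ∘ reflection)
  ∑-elements φ = begin
    ∑ elements φ
      ≡⟨ ∑-++ (map rotation (allFin p)) (map reflection (allFin p)) φ ⟩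
    ∑ (map rotation (allFin p)) φ + ∑ (map reflection (allFin p)) φ
      ≡⟨ cong₂ _+_ (cong (λ xs → ∑ xs φ) (map-tabulate (λ i → i) rotation))
                   (cong (λ xs → ∑ xs φ) (map-tabulate (λ i → i) reflection)) ⟩
    ∑ (tabulate rotation) φ + ∑ (tabulate reflection) φ
      ≡⟨ cong₂ _+_ (∑-tabulate rotation φ) (∑-tabulate reflection φ) ⟩
    sum (φ ∘ rotation) + sum (φ ∘ reflection)
      ∎
    where open ≡-Reasoning

  sum-∘-permutation : (π : Permutation′ p) (ψ : Fin p → Carrier) → sum (ψ ∘ (π ⟨$⟩ʳ_)) ≡ sum ψ
  sum-∘-permutation π ψ = sym (sum-permute ψ π)

  -- On the two cosets of the rotation subgroup, h ↦ g⁻¹h acts by translations when g is a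
  -- rotation and by reflections exchanging the cosets when g is a reflection; g ↦ g⁻¹h acts
  -- likewise with the roles of translations and reflections interchanged.
  ∑[h]φ[g⁻¹h]≡∑φ : ∀ g φ → ∑[ h ∈ elements ] φ (inv g · h) ≡ ∑ elements φ
  ∑[h]φ[g⁻¹h]≡∑φ (false , a) φ = begin
    ∑[ h ∈ elements ] φ (inv (false , a) · h)
      ≡⟨ ∑-elements (λ h → φ (inv (false , a) · h)) ⟩
    sum (φ₀ ∘ translate c) + sum (φ₁ ∘ translate c)
      ≡⟨ cong₂ _+_ (sum-∘-permutation (translate↔ c) φ₀) (sum-∘-permutation (translate↔ c) φ₁) ⟩
    sum φ₀ + sum φ₁
      ≡⟨ ∑-elements φ ⟨
    ∑ elements φ
      ∎
    where
    open ≡-Reasoning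
    c = toℕ ((p ℕ.∸ toℕ a) mod p)
    φ₀ = φ ∘ rotation
    φ₁ = φ ∘ reflection
  ∑[h]φ[g⁻¹h]≡∑φ (true , a) φ = begin
    ∑[ h ∈ elements ] φ (inv (true , a) · h)
      ≡⟨ ∑-elements (λ h → φ (inv (true , a) · h)) ⟩
    sum (φ₁ ∘ (reflect↔ (toℕ a) ⟨$⟩ʳ_)) + sum (φ₀ ∘ (reflect↔ (toℕ a) ⟨$⟩ʳ_))
      ≡⟨ cong₂ _+_ (sum-∘-permutation (reflect↔ (toℕ a)) φ₁) (sum-∘-permutation (reflect↔ (toℕ a)) φ₀) ⟩
    sum φ₁ + sum φ₀
      ≡⟨ +-comm (sum φ₁) (sum φ₀) ⟩
    sum φ₀ + sum φ₁
      ≡⟨ ∑-elements φ ⟨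
    ∑ elements φ
      ∎
    where
    open ≡-Reasoning
    φ₀ = φ ∘ rotation
    φ₁ = φ ∘ reflection

  ∑[g]φ[g⁻¹h]≡∑φ : ∀ h φ → ∑[ g ∈ elements ] φ (inv g · h) ≡ ∑ elements φ
  ∑[g]φ[g⁻¹h]≡∑φ (b , j) φ = begin
    ∑[ g ∈ elements ] φ (inv g · (b , j))
      ≡⟨ ∑-elements (λ g → φ (inv g · (b , j))) ⟩
    sum (λ (i : Fin p) → φ (b , translate (toℕ ((p ℕ.∸ toℕ i) mod p)) j))
      + sum (λ (i : Fin p) → φ (not b , (toℕ i ℕ.+ (p ℕ.∸ toℕ j)) mod p))
      ≡⟨ cong₂ _+_ (sum-cong-≗ rotations) (sum-cong-≗ reflections) ⟩
    sum (φ₀ ∘ (reflect↔ (toℕ j) ⟨$⟩ʳ_)) + sum (φ₁ ∘ (translate↔ (p ℕ.∸ toℕ j) ⟨$⟩ʳ_))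
      ≡⟨ cong₂ _+_ (sum-∘-permutation (reflect↔ (toℕ j)) φ₀)
                   (sum-∘-permutation (translate↔ (p ℕ.∸ toℕ j)) φ₁) ⟩
    sum φ₀ + sum φ₁
      ≡⟨ fibres b ⟩
    ∑ elements φ
      ∎
    where
    open ≡-Reasoning
    φ₀ = λ i → φ (b , i)
    φ₁ = λ i → φ (not b , i)
    rotations : ∀ i → φ₀ (translate (toℕ ((p ℕ.∸ toℕ i) mod p)) j) ≡ φ₀ (reflect↔ (toℕ j) ⟨$⟩ʳ i)
    rotations i = cong φ₀ (translate-by-negative i j)
    reflections : ∀ i → φ₁ ((toℕ i ℕ.+ (p ℕ.∸ toℕ j)) mod p) ≡ φ₁ (translate↔ (p ℕ.∸ toℕ j) ⟨$⟩ʳ i)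
    reflections i = cong (λ k → φ₁ (k mod p)) (ℕ.+-comm (toℕ i) (p ℕ.∸ toℕ j))
    fibres : ∀ b → sum (λ i → φ (b , i)) + sum (λ i → φ (not b , i)) ≡ ∑ elements φ
    fibres false = sym (∑-elements φ)
    fibres true  = trans (+-comm _ _) (sym (∑-elements φ))

  eigenvalue-bound : ∀ S {λ′} → IsEigenvalue R S λ′ → λ′ ≢ fromℕ (card S) →
                     ∣ λ′ ∣ ≤ fromℕ (card (not ∘ S))
  eigenvalue-bound S (v , v≢0 , eigen) = Z.eigenvalue-bound eigen column-sum row-sum v≢0
    where
    module Z = ZeroOneMatrix R elements ∈-elements (λ g h → S (inv g · h))
    column-sum : ∀ h → ∑[ g ∈ elements ] ind (S (inv g · h)) ≡ fromℕ (card S)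
    column-sum h = trans (∑[g]φ[g⁻¹h]≡∑φ h (ind ∘ S)) (sym (fromℕ-count S elements))
    row-sum : ∀ g → ∑[ h ∈ elements ] ind (not (S (inv g · h))) ≡ fromℕ (card (not ∘ S))
    row-sum g = trans (∑[h]φ[g⁻¹h]≡∑φ g (ind ∘ not ∘ S)) (sym (fromℕ-count (not ∘ S) elements))

  ramanujan-criterion : ∀ S → (2 ℕ.* p ℕ.∸ card S) ℕ.* (2 ℕ.* p ℕ.∸ card S) ℕ.≤ 4 ℕ.* (card S ℕ.∸ 1) →
                        Ramanujan R S
  ramanujan-criterion S d²≤4[k∸1] λ′ eigenvalue λ′≢k _ = begin
    λ′ * λ′                                ≡⟨ x*x≡∣x∣*∣x∣ λ′ ⟩
    ∣ λ′ ∣ * ∣ λ′ ∣                        ≤⟨ x*x≤y*y (0≤∣x∣ λ′) (eigenvalue-bound S eigenvalue λ′≢k) ⟩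
    fromℕ k′ * fromℕ k′                    ≡⟨ fromℕ-* k′ k′ ⟨
    fromℕ (k′ ℕ.* k′)                      ≡⟨ cong (λ d → fromℕ (d ℕ.* d)) k′≡2p∸k ⟩
    fromℕ ((2 ℕ.* p ℕ.∸ k) ℕ.* (2 ℕ.* p ℕ.∸ k)) ≤⟨ fromℕ-mono-≤ d²≤4[k∸1] ⟩
    fromℕ (4 ℕ.* (k ℕ.∸ 1))                ∎
    where
    open ≤-Reasoning
    k  = card S
    k′ = card (not ∘ S)
    k′≡2p∸k : k′ ≡ 2 ℕ.* p ℕ.∸ k
    k′≡2p∸k = trans (sym (ℕ.m+n∸m≡n k k′)) (cong (ℕ._∸ k) (card-complement S))

-- Cayley subsets of every size from p to 2p − 1

open import Data.Nat using (_+_; _*_; _∸_; _≤_; _<_; _<ᵇ_; z≤n; s≤s)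

module RotationsAndReflections (n c : ℕ) where

  open Modular n using (p; toℕ-mod-<; toℕ-mod-toℕ; p-mod-p)
  open Dihedral p
  open DihedralElements n using (rotation; reflection)
  open import Data.List.Relation.Unary.All using (All; []; _∷_)

  S : Subset
  S (false , i) = 0 <ᵇ toℕ i
  S (true  , j) = toℕ j <ᵇ suc c

  inverse-of-nontrivial-rotation : ∀ i → S (inv (false , Fin.suc i)) ≡ true
  inverse-of-nontrivial-rotation i = begin
    0 <ᵇ toℕ ((n ∸ toℕ i) mod p)  ≡⟨ cong (0 <ᵇ_) (toℕ-mod-< (s≤s (ℕ.m∸n≤m n (toℕ i)))) ⟩
    0 <ᵇ (n ∸ toℕ i)              ≡⟨ Equivalence.to T-≡ (ℕ.<⇒<ᵇ (ℕ.m<n⇒0<n∸m (toℕ<n i))) ⟩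
    true                          ∎
    where open ≡-Reasoning

  [i+0]mod-p≡i : ∀ i → (toℕ i + 0) mod p ≡ i
  [i+0]mod-p≡i i = trans (cong (_mod p) (ℕ.+-identityʳ (toℕ i))) (toℕ-mod-toℕ i)

  rotation·e : ∀ i → rotation i · e ≡ rotation i
  rotation·e i = cong (false ,_) ([i+0]mod-p≡i i)

  y·e : (true , Fin.zero) · e ≡ (true , Fin.zero)
  y·e = cong (true ,_) p-mod-p

  isCayleySubset : CayleySubset S
  isCayleySubset = record
    { no-identity = λ ()
    ; symmetric   = symmetric
    ; generates   = generates
    }
    where
    symmetric : ∀ g → g ∈S S → inv g ∈S S
    symmetric (false , Fin.suc i) _   = inverse-of-nontrivial-rotation i
    symmetric (true  , j)         j∈S = j∈S
    generates : ∀ g → ∃[ w ] (All (_∈S S) w × prod w ≡ g)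
    generates (false , Fin.zero)  = [] , [] , refl
    generates (false , Fin.suc i) = (false , Fin.suc i) ∷ [] , refl ∷ [] , rotation·e (Fin.suc i)
    generates (true  , Fin.zero)  = (true , Fin.zero) ∷ [] , refl ∷ [] , y·e
    generates (true  , Fin.suc j) = (false , Fin.suc j) ∷ (true , Fin.zero) ∷ [] , refl ∷ refl ∷ [] ,
      trans (cong ((false , Fin.suc j) ·_) y·e) (cong (true ,_) ([i+0]mod-p≡i (Fin.suc j)))

  card-S : c < p → card S ≡ n + suc c
  card-S c<p = begin
    card S
      ≡⟨ count-++ S (map rotation (allFin p)) _ ⟩
    count S (map rotation (allFin p)) + count S (map reflection (allFin p))
      ≡⟨ cong₂ (λ xs ys → count S xs + count S ys)
               (map-tabulate (λ i → i) rotation) (map-tabulate (λ i → i) reflection) ⟩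
    count S (tabulate rotation) + count S (tabulate reflection)
      ≡⟨ cong₂ _+_ (count-tabulate-all S (rotation ∘ Fin.suc) (λ _ → refl))
                   (count-tabulate-<ᵇ S reflection (suc c) c<p (λ _ → refl)) ⟩
    n + suc c
      ∎
    where open ≡-Reasoning

1≤l≤p⇒InL : ∀ n {l} → 1 ≤ l → l ≤ suc n → Dihedral.InL (suc n) l
1≤l≤p⇒InL n {l} 1≤l l≤p = S , isCayleySubset , 2p∸card-S≡l
  where
  p = suc n
  open RotationsAndReflections n (p ∸ l) using (S; isCayleySubset; card-S)
  open Dihedral p using (card)
  2p∸card-S≡l : 2 * p ∸ card S ≡ l
  2p∸card-S≡l = begin
    2 * p ∸ card S               ≡⟨ cong (2 * p ∸_) (card-S (s≤s (ℕ.∸-monoʳ-≤ p 1≤l))) ⟩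
    2 * p ∸ (n + suc (p ∸ l))    ≡⟨ cong (2 * p ∸_) (ℕ.+-suc n (p ∸ l)) ⟩
    (p + (p + 0)) ∸ (p + (p ∸ l)) ≡⟨ ℕ.[m+n]∸[m+o]≡n∸o p (p + 0) (p ∸ l) ⟩
    (p + 0) ∸ (p ∸ l)            ≡⟨ cong (_∸ (p ∸ l)) (ℕ.+-identityʳ p) ⟩
    p ∸ (p ∸ l)                  ≡⟨ ℕ.m∸[m∸n]≡n l≤p ⟩
    l                            ∎
    where open ≡-Reasoning

-- Arithmetic of ⌊√(8p)⌋

[d+2]²≡d²+4+4d : ∀ d → (d + 2) * (d + 2) ≡ d * d + 4 + 4 * d
[d+2]²≡d²+4+4d = solve-∀
  where open import Data.Nat.Tactic.RingSolver using (solve-∀)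

[m∸k]²≤4[k∸1] : ∀ {m k b} → k ≤ m → 2 ≤ b → b * b ≤ 4 * m → m ∸ k ≤ b ∸ 2 →
                (m ∸ k) * (m ∸ k) ≤ 4 * (k ∸ 1)
[m∸k]²≤4[k∸1] {m} {k} {b} k≤m 2≤b b²≤4m d≤b∸2 = begin
  d * d            ≤⟨ ℕ.m+n≤o⇒m≤o∸n (d * d) d²+4≤4k ⟩
  4 * k ∸ 4        ≡⟨ ℕ.*-distribˡ-∸ 4 k 1 ⟨
  4 * (k ∸ 1)      ∎
  where
  open ℕ.≤-Reasoning
  d = m ∸ k
  d+2≤b : d + 2 ≤ b
  d+2≤b = subst (d + 2 ≤_) (ℕ.m∸n+n≡m 2≤b) (ℕ.+-monoˡ-≤ 2 d≤b∸2)
  d²+4≤4k : d * d + 4 ≤ 4 * k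
  d²+4≤4k = ℕ.+-cancelʳ-≤ (4 * d) (d * d + 4) (4 * k) (begin
    d * d + 4 + 4 * d   ≡⟨ [d+2]²≡d²+4+4d d ⟨
    (d + 2) * (d + 2)   ≤⟨ ℕ.*-mono-≤ d+2≤b d+2≤b ⟩
    b * b               ≤⟨ b²≤4m ⟩
    4 * m               ≡⟨ cong (4 *_) (ℕ.m+[n∸m]≡n k≤m) ⟨
    4 * (k + d)         ≡⟨ ℕ.*-distribˡ-+ 4 k d ⟩
    4 * k + 4 * d       ∎)

8≤⌊√8p⌋ : ∀ {p b} → 8 ≤ p → 8 * p < suc b * suc b → 8 ≤ b
8≤⌊√8p⌋ {p} {b} 8≤p 8p<[1+b]² = ℕ.≮⇒≥ λ b<8 → ℕ.<⇒≱ 8p<[1+b]² (begin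
  suc b * suc b  ≤⟨ ℕ.*-mono-≤ b<8 b<8 ⟩
  8 * 8          ≤⟨ ℕ.*-monoʳ-≤ 8 8≤p ⟩
  8 * p          ∎)
  where open ℕ.≤-Reasoning

⌊√8p⌋≤p : ∀ {p b} → 8 ≤ b → b * b ≤ 8 * p → b ≤ p
⌊√8p⌋≤p {p} {b} 8≤b b²≤8p = ℕ.*-cancelˡ-≤ 8 (ℕ.≤-trans (ℕ.*-monoˡ-≤ b 8≤b) b²≤8p)

lemma4p2 : (R : RealField) (p : ℕ) .{{_ : NonZero p}} → Prime p → 29 ≤ p →
    (b : ℕ) → b * b ≤ 8 * p → 8 * p < suc b * suc b →
    ∃[ l ] (Dihedral.InL p l ×
            (∀ S → Dihedral.CayleySubset p S →
               1 ≤ (2 * p) ∸ Dihedral.card p S → (2 * p) ∸ Dihedral.card p S ≤ l →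
               Dihedral.Ramanujan p R S) ×
            b ∸ 2 ≤ l)
lemma4p2 R zero    _ ()
lemma4p2 R (suc n) _ 29≤p b b²≤8p 8p<[1+b]² = b ∸ 2 , 1≤l≤p⇒InL n 1≤b∸2 b∸2≤p , ramanujan , ℕ.≤-refl
  where
  p = suc n
  open DihedralElements n using (card≤2p)
  open DihedralCayleyGraph R n using (ramanujan-criterion)
  open Dihedral p using (CayleySubset; card; Ramanujan)
  8≤b : 8 ≤ b
  8≤b = 8≤⌊√8p⌋ (ℕ.≤-trans (ℕ.m≤m+n 8 21) 29≤p) 8p<[1+b]²
  1≤b∸2 : 1 ≤ b ∸ 2
  1≤b∸2 = ℕ.∸-monoˡ-≤ 2 (ℕ.≤-trans (ℕ.m≤m+n 3 5) 8≤b)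
  b∸2≤p : b ∸ 2 ≤ p
  b∸2≤p = ℕ.≤-trans (ℕ.m∸n≤m b 2) (⌊√8p⌋≤p 8≤b b²≤8p)
  ramanujan : ∀ S → CayleySubset S → 1 ≤ 2 * p ∸ card S → 2 * p ∸ card S ≤ b ∸ 2 → Ramanujan R S
  ramanujan S _ _ 2p∸k≤b∸2 = ramanujan-criterion S
    ([m∸k]²≤4[k∸1] (card≤2p S)
                   (ℕ.≤-trans (ℕ.m≤m+n 2 6) 8≤b)
                   (subst (b * b ≤_) (ℕ.*-assoc 4 2 p) b²≤8p)
                   2p∸k≤b∸2)
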